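{- Let $f:Q_1^L\to\mathbb Z$, $g:Q_2^R\to\mathbb Z$ and let $\Gamma$ be an integer such that the bucketings below exist. Then there are at most $2\Gamma$ pairs $(a, b) \in [\Gamma]\times[\Gamma]$ such that $R^{(f)}_{a} \cap R^{(g)}_{b} \ne \emptyset$.
   Context: $Q_1,Q_2,L,R$ are finite sets. $Q_1^L$ is partitioned into $\Gamma$ sets $B^{(f)}_1,\dots,B^{(f)}_\Gamma$ of equal size such that $x\in B^{(f)}_i$, $y\in B^{(f)}_j$, $i<j$ imply $f(x)<f(y)$; similarly $Q_2^R$ into $B^{(g)}_1,\dots,B^{(g)}_\Gamma$ with respect to $g$. $R^{(f)}_a$ is the smallest interval of $\mathbb Z$ containing $f(B^{(f)}_a)$, and $R^{(g)}_b$ the smallest interval containing $g(B^{(g)}_b)$. -}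

module Defs where

open import Data.Nat using (ℕ)
open import Data.Fin using (Fin)
import Data.Fin as F
open import Data.Integer using (ℤ; _≤_; _<_)
open import Data.Product using (Σ; _×_; ∃)
open import Relation.Binary.PropositionalEquality using (_≡_)
open import Function.Bundles using (_↔_)

-- A^B for finite sets A = Fin a, B = Fin b : functions B → A.
Pow : ℕ → ℕ → Set
Pow q l = Fin l → Fin q

-- A bucketing of a finite set X into Γ buckets with respect to h : X → ℤ.
-- bucket x is the (unique) index of the bucket containing x, so the buckets
-- B_a = { x | bucket x ≡ a } form a partition of X (some may be empty only if
-- all are, by the equal-size condition).
record Bucketing (X : Set) (h : X → ℤ) (Γ : ℕ) : Set where
  field
    bucket    : X → Fin Γ
    equalSize : (a b : Fin Γ) →
                (Σ X (λ x → bucket x ≡ a)) ↔ (Σ X (λ x → bucket x ≡ b))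
    ordered   : (x y : X) → bucket x F.< bucket y → h x < h y

open Bucketing public

-- z ∈ R_a : membership in the smallest interval of ℤ containing h(B_a),
-- i.e. z lies between two values of h on B_a.
InRange : {X : Set} {h : X → ℤ} {Γ : ℕ} → Bucketing X h Γ → Fin Γ → ℤ → Set
InRange {X} {h} B a z =
  Σ X (λ x → Σ X (λ y →
    (bucket B x ≡ a) × (bucket B y ≡ a) × (h x ≤ z) × (z ≤ h y)))

Intersects : {X Y : Set} {f : X → ℤ} {g : Y → ℤ} {Γ : ℕ} →
             Bucketing X f Γ → Bucketing Y g Γ → Fin Γ → Fin Γ → Set
Intersects Bf Bg a b = ∃ (λ z → InRange Bf a z × InRange Bg b z)

module Submission where

open import Defs
open import Data.Nat using (ℕ; _≤_; _*_)
open import Data.Fin using (Fin)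
open import Data.Integer using (ℤ)
open import Data.Product using (_×_; proj₁; proj₂)
open import Data.List using (List; length)
open import Data.List.Relation.Unary.All using (All)
open import Data.List.Relation.Unary.Unique.Propositional using (Unique)

open import Data.Empty using (⊥-elim)
open import Data.Fin as Fin using (zero; suc; toℕ; fromℕ<)
open import Data.Fin.Properties using (injective⇒≤; toℕ-injective; toℕ-fromℕ<; toℕ<n)
import Data.Integer as ℤ
import Data.Integer.Properties as ℤ
open import Data.List using (lookup)
import Data.List.Relation.Unary.All as All
open import Data.List.Relation.Unary.AllPairs using (_∷_)
open import Data.List.Membership.Propositional.Properties using (∈-lookup)
import Data.Nat as ℕ
open import Data.Nat.Properties
  using (<-cmp; <-irrefl; <⇒≤; ≮⇒≥; +-mono-<-≤; +-cancelˡ-≡; +-identityʳ)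
open import Data.Product using (_,_)
open import Function.Definitions using (Injective)
open import Relation.Binary.Definitions using (tri<; tri≈; tri>)
open import Relation.Binary.PropositionalEquality
  using (_≡_; refl; sym; cong; cong₂; subst; module ≡-Reasoning)

-- Since bucket a lies entirely below bucket a' whenever a < a', so do the
-- intervals R_a and R_a'. Hence if R^(f)_a meets R^(g)_b and R^(f)_a' meets R^(g)_b'
-- with a < a', then b ≤ b': the intersecting pairs form a chain in the product order,
-- on which (a , b) ↦ a + b is injective. It takes values below 2Γ, which bounds the
-- number of pairs.

Unique⇒lookup-injective : {A : Set} {xs : List A} → Unique xs → Injective _≡_ _≡_ (lookup xs)
Unique⇒lookup-injective (_ ∷ _)     {zero}  {zero}  _  = refl
Unique⇒lookup-injective (x≢xs ∷ _)  {zero}  {suc j} eq = ⊥-elim (All.lookup x≢xs (∈-lookup j) eq)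
Unique⇒lookup-injective (x≢xs ∷ _)  {suc i} {zero}  eq = ⊥-elim (All.lookup x≢xs (∈-lookup i) (sym eq))
Unique⇒lookup-injective (_ ∷ uniq)  {suc i} {suc j} eq = cong suc (Unique⇒lookup-injective uniq eq)

Unique⇒length≤ : {A : Set} {P : A → Set} {n : ℕ} {xs : List A} (h : A → Fin n) →
                 (∀ {x y} → P x → P y → h x ≡ h y → x ≡ y) →
                 Unique xs → All P xs → length xs ≤ n
Unique⇒length≤ h h-injectiveOnP uniq pxs = injective⇒≤ λ {i} {j} hi≡hj →
  Unique⇒lookup-injective uniq
    (h-injectiveOnP (All.lookup pxs (∈-lookup i)) (All.lookup pxs (∈-lookup j)) hi≡hj)

+-injectiveOnChains : ∀ {a b a′ b′} → (a ℕ.< a′ → b ℕ.≤ b′) → (a′ ℕ.< a → b′ ℕ.≤ b) →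
                      a ℕ.+ b ≡ a′ ℕ.+ b′ → a ≡ a′ × b ≡ b′
+-injectiveOnChains {a} {b} {a′} {b′} up down eq with <-cmp a a′
... | tri< a<a′ _ _ = ⊥-elim (<-irrefl eq (+-mono-<-≤ a<a′ (up a<a′)))
... | tri> _ _ a′<a = ⊥-elim (<-irrefl (sym eq) (+-mono-<-≤ a′<a (down a′<a)))
... | tri≈ _ refl _ = refl , +-cancelˡ-≡ a b b′ eq

inRange-< : ∀ {X : Set} {h : X → ℤ} {Γ : ℕ} (B : Bucketing X h Γ) {a a′ : Fin Γ} {z z′ : ℤ} →
            InRange B a z → InRange B a′ z′ → a Fin.< a′ → z ℤ.< z′
inRange-< B (_ , y , _ , refl , _ , z≤hy) (x′ , _ , refl , _ , hx′≤z′ , _) a<a′ =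
  ℤ.≤-<-trans z≤hy (ℤ.<-≤-trans (ordered B y x′ a<a′) hx′≤z′)

sumIndex : {Γ : ℕ} → Fin Γ × Fin Γ → Fin (2 * Γ)
sumIndex {Γ} (a , b) = fromℕ< a+b<2Γ
  where
  a+b<2Γ : toℕ a ℕ.+ toℕ b ℕ.< 2 * Γ
  a+b<2Γ = subst (toℕ a ℕ.+ toℕ b ℕ.<_) (cong (Γ ℕ.+_) (sym (+-identityʳ Γ)))
                 (+-mono-<-≤ (toℕ<n a) (<⇒≤ (toℕ<n b)))

toℕ-sumIndex : {Γ : ℕ} (p : Fin Γ × Fin Γ) → toℕ (sumIndex p) ≡ toℕ (proj₁ p) ℕ.+ toℕ (proj₂ p)
toℕ-sumIndex _ = toℕ-fromℕ< _

module _ {X Y : Set} {f : X → ℤ} {g : Y → ℤ} {Γ : ℕ}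
         (Bf : Bucketing X f Γ) (Bg : Bucketing Y g Γ) where

  intersects-monotone : ∀ {a b a′ b′} → Intersects Bf Bg a b → Intersects Bf Bg a′ b′ →
                        a Fin.< a′ → b Fin.≤ b′
  intersects-monotone (z , zf , zg) (z′ , z′f , z′g) a<a′ = ≮⇒≥ λ b′<b →
    ℤ.<-asym (inRange-< Bf zf z′f a<a′) (inRange-< Bg z′g zg b′<b)

  sumIndex-injectiveOnIntersecting : ∀ {p p′ : Fin Γ × Fin Γ} →
    Intersects Bf Bg (proj₁ p) (proj₂ p) → Intersects Bf Bg (proj₁ p′) (proj₂ p′) →
    sumIndex p ≡ sumIndex p′ → p ≡ p′
  sumIndex-injectiveOnIntersecting {a , b} {a′ , b′} I I′ eq =
    cong₂ _,_ (toℕ-injective (proj₁ toℕ≡)) (toℕ-injective (proj₂ toℕ≡))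
    where
    open ≡-Reasoning
    toℕ-sum≡ : toℕ a ℕ.+ toℕ b ≡ toℕ a′ ℕ.+ toℕ b′
    toℕ-sum≡ = begin
      toℕ a ℕ.+ toℕ b          ≡⟨ toℕ-sumIndex (a , b) ⟨
      toℕ (sumIndex (a , b))   ≡⟨ cong toℕ eq ⟩
      toℕ (sumIndex (a′ , b′)) ≡⟨ toℕ-sumIndex (a′ , b′) ⟩
      toℕ a′ ℕ.+ toℕ b′        ∎

    toℕ≡ : toℕ a ≡ toℕ a′ × toℕ b ≡ toℕ b′
    toℕ≡ = +-injectiveOnChains (intersects-monotone I I′) (intersects-monotone I′ I) toℕ-sum≡

lemma5p2 : (q₁ q₂ l r Γ : ℕ) (f : Pow q₁ l → ℤ) (g : Pow q₂ r → ℤ)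
           (Bf : Bucketing (Pow q₁ l) f Γ) (Bg : Bucketing (Pow q₂ r) g Γ)
           (ps : List (Fin Γ × Fin Γ)) → Unique ps →
           All (λ p → Intersects Bf Bg (proj₁ p) (proj₂ p)) ps →
           length ps ≤ 2 * Γ
lemma5p2 _ _ _ _ _ _ _ Bf Bg _ uniq intersecting =
  Unique⇒length≤ sumIndex (sumIndex-injectiveOnIntersecting Bf Bg) uniq intersecting
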